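{- Let $\pi\in S_n$ have pinnacles $y_1,\ldots,y_p$ in left-to-right order. Let $k\ge 1$ be such that $\{y_1,\ldots,y_k\}$ consists of the $k$ smallest pinnacles of $\pi$, and let $y_t$, with $t\neq k+1$, be the $(k+1)$-th smallest pinnacle of $\pi$. Then there is a reversal $\rho$ that is balanced for $\pi$ such that in $\pi\cdot\rho$ the $(k+1)$-th pinnacle from the left is $y_t$, and for every $s\in\{1,\ldots,k\}\cup\{t+1,\ldots,p\}$ the $s$-th pinnacle from the left of $\pi\cdot\rho$ is $y_s$ (these pinnacles are not modified).
   Context: Convention: a permutation $\pi=(\pi_1\,\ldots\,\pi_n)\in S_n$ is always extended by $\pi_0=n+1$ and $\pi_{n+1}=n+2$. A pinnacle of $\pi$ is an element $\pi_i$ with $1\le i\le n$ and $\pi_{i-1}<\pi_i>\pi_{i+1}$; the pinnacle set is the set of pinnacles. For elements $w_1=\pi_a$, $w_2=\pi_b$ with $1\le a\le b\le n$, the reversal $\rho(w_1,w_2)$ transforms $\pi$ into $\pi\cdot\rho(w_1,w_2)=(\pi_0\ldots\pi_{a-1}\,\pi_b\,\pi_{b-1}\ldots\pi_a\,\pi_{b+1}\ldots\pi_{n+1})$. It is balanced for $\pi$ if $\pi$ and $\pi\cdot\rho(w_1,w_2)$ have the same pinnacle set. -}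

module Defs where

open import Data.Nat using (ℕ; zero; suc; _+_; _∸_; _<ᵇ_)
open import Data.Bool using (Bool; true; false; _∧_; if_then_else_)
open import Data.List using (List; []; _∷_; _++_; take; drop; reverse)
open import Data.Maybe using (Maybe; just; nothing)

-- Extended permutation: π₀ = n+1, π_{n+1} = n+2.
ext : ℕ → List ℕ → List ℕ
ext n π = (n + 1) ∷ (π ++ ((n + 2) ∷ []))

pinsSeq : List ℕ → List ℕ
pinsSeq (x ∷ y ∷ z ∷ rest) =
  if (x <ᵇ y) ∧ (z <ᵇ y) then y ∷ pinsSeq (y ∷ z ∷ rest) else pinsSeq (y ∷ z ∷ rest)
pinsSeq _ = []

pins : ℕ → List ℕ → List ℕ
pins n π = pinsSeq (ext n π)

-- 1-based access: at xs i = just x_i for 1 ≤ i ≤ length xs, otherwise nothing.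
at : List ℕ → ℕ → Maybe ℕ
at xs zero = nothing
at [] (suc i) = nothing
at (x ∷ xs) (suc zero) = just x
at (x ∷ xs) (suc (suc i)) = at xs (suc i)

-- The reversal between positions a ≤ b (1-based): π ⋅ ρ(π_a, π_b).
revAt : ℕ → ℕ → List ℕ → List ℕ
revAt a b π = take (a ∸ 1) π ++ reverse (drop (a ∸ 1) (take b π)) ++ drop b π

module Submission where

-- Let m₁ be the valley following the k-th pinnacle y_k and m₂ the valley following y_t.
-- Exactly k pinnacles lie below y, namely y₁ … y_k, so every pinnacle between m₁ and m₂
-- is at least y, which exceeds both m₁ (as m₁ < y_k < y) and m₂ (as m₂ < y_t = y).
-- Splitting the sequence at the two valleys separates its pinnacles into the three blocks
-- before m₁, between m₁ and m₂, and after m₂. Reversing the segment strictly between m₁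
-- and m₂ keeps the outer blocks and reverses the middle one: the reversed segment now has
-- m₂ on its left and m₁ on its right, but both valleys are below every pinnacle of the
-- window, so the swap changes nothing. Hence y moves from position t to position k + 1 and
-- all positions up to k and beyond t are unchanged. The sentinels n + 1 and n + 2 lie
-- outside the segment, so the reversal acts inside π.

open import Data.Bool using (true; false; _∧_; T)
open import Data.Empty using (⊥; ⊥-elim)
open import Data.List using (List; []; _∷_; _++_; _∷ʳ_; take; drop; applyUpTo; reverse; length; filter; initLast; _∷ʳ′_)
open import Data.List.Properties
  using (++-assoc; ++-identityʳ; ++-conicalʳ; ∷-injectiveˡ; ∷-injectiveʳ; ∷ʳ-injective; ∷ʳ-injectiveʳ;
         reverse-++; unfold-reverse; length-++; length-reverse; length-applyUpTo; applyUpTo-∷ʳ;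
         filter-++; filter-all; filter-none; filter-notAll; filter-some)
open import Data.List.Membership.Propositional using (_∈_; lose)
open import Data.List.Membership.Propositional.Properties using (∈-++⁺ˡ; ∈-++⁺ʳ; ∈-++⁻; ∈-applyUpTo⁻)
open import Data.List.Relation.Unary.All using (All)
import Data.List.Relation.Unary.All as All
open import Data.List.Relation.Unary.Any using (here; there)
import Data.List.Relation.Unary.Any as Any
open import Data.List.Relation.Unary.Linked using (Linked; _∷_)
import Data.List.Relation.Unary.Linked as Linked
open import Data.List.Relation.Unary.Linked.Properties using (AllPairs⇒Linked)
open import Data.List.Relation.Unary.Unique.Propositional using (Unique)
import Data.List.Relation.Unary.Unique.Propositional.Properties as Unique
open import Data.List.Relation.Binary.Permutation.Propositional using (_↭_; ↭-sym; ↭-trans; ↭-reflexive; ↭⇒↭ₛ)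
open import Data.List.Relation.Binary.Permutation.Propositional.Properties
  using (shift; ↭-length; ∈-resp-↭; ++⁺ˡ; ++⁺ʳ; ↭-reverse)
open import Data.Maybe using (just)
open import Data.Maybe.Properties using (just-injective)
open import Data.Nat using (ℕ; zero; suc; _+_; _∸_; _≤_; _<_; _<ᵇ_; _<?_; s≤s; z≤n)
open import Data.Nat.Properties
  using (module ≤-Reasoning; ≤-pred; ≤-trans; ≤-reflexive; <-trans; <-asym; <-irrefl; <-cmp;
         ≤-<-trans; <-≤-trans; <⇒≤; ≰⇒>; ≮⇒≥; <⇒<ᵇ; <ᵇ⇒<; m≤m+n; m<m+n; m+n∸m≡n; m+[n∸m]≡n;
         +-suc; +-comm; +-identityʳ; +-cancelˡ-≡; +-monoʳ-≤; +-monoʳ-<; suc-injective)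
open import Data.Product using (Σ; ∃; ∃₂; _×_; _,_; proj₁; proj₂)
open import Data.Sum using (inj₁; inj₂)
open import Function.Base using (case_of_)
open import Function.Bundles using (_⇔_; mk⇔)
open import Relation.Binary.Definitions using (tri<; tri≈; tri>)
open import Relation.Binary.PropositionalEquality
open import Data.List.Relation.Binary.Permutation.Setoid.Properties (setoid ℕ) using (Unique-resp-↭)
open import Relation.Nullary using (¬_; yes; no)
open import Relation.Nullary.Decidable using (_×-dec_)

open import Defs

<ᵇ-true : ∀ {x y} → x < y → (x <ᵇ y) ≡ true
<ᵇ-true {x} {y} x<y with x <ᵇ y | <⇒<ᵇ x<y
... | true | _ = refl

<ᵇ-false : ∀ {x y} → ¬ x < y → (x <ᵇ y) ≡ false
<ᵇ-false {x} {y} x≮y with x <ᵇ y in eq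
... | true = ⊥-elim (x≮y (<ᵇ⇒< x y (subst T (sym eq) _)))
... | false = refl

pinsSeq-peak : ∀ {x y z} zs → x < y → z < y → pinsSeq (x ∷ y ∷ z ∷ zs) ≡ y ∷ pinsSeq (y ∷ z ∷ zs)
pinsSeq-peak _ x<y z<y rewrite <ᵇ-true x<y | <ᵇ-true z<y = refl

pinsSeq-notPeakˡ : ∀ {x y} zs → ¬ x < y → pinsSeq (x ∷ y ∷ zs) ≡ pinsSeq (y ∷ zs)
pinsSeq-notPeakˡ [] _ = refl
pinsSeq-notPeakˡ (_ ∷ _) x≮y rewrite <ᵇ-false x≮y = refl

pinsSeq-notPeakʳ : ∀ {x y z} zs → ¬ z < y → pinsSeq (x ∷ y ∷ z ∷ zs) ≡ pinsSeq (y ∷ z ∷ zs)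
pinsSeq-notPeakʳ {x} {y} _ z≮y rewrite <ᵇ-false z≮y with x <ᵇ y
... | true = refl
... | false = refl

pinsSeq-notPeak : ∀ {x y z} zs → ¬ (x < y × z < y) → pinsSeq (x ∷ y ∷ z ∷ zs) ≡ pinsSeq (y ∷ z ∷ zs)
pinsSeq-notPeak {x} {y} {z} zs ¬peak with x <? y
... | yes x<y = pinsSeq-notPeakʳ zs (λ z<y → ¬peak (x<y , z<y))
... | no x≮y = pinsSeq-notPeakˡ (z ∷ zs) x≮y

pinsSeq-∷ : ∀ x xs → pinsSeq (x ∷ xs) ≡ pinsSeq (x ∷ take 2 xs) ++ pinsSeq xs
pinsSeq-∷ x [] = refl
pinsSeq-∷ x (y ∷ []) = refl
pinsSeq-∷ x (y ∷ z ∷ zs) with (x <ᵇ y) ∧ (z <ᵇ y)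
... | true = refl
... | false = refl

take-2-++ : ∀ (L : List ℕ) a b X Y → take 2 (L ++ a ∷ b ∷ X) ≡ take 2 (L ++ a ∷ b ∷ Y)
take-2-++ [] a b X Y = refl
take-2-++ (_ ∷ []) a b X Y = refl
take-2-++ (_ ∷ _ ∷ _) a b X Y = refl

-- Whether an entry is a pinnacle depends only on its two neighbours, so the
-- pinnacle list splits at any two consecutive entries.
pinsSeq-++ : ∀ L a b R → pinsSeq (L ++ a ∷ b ∷ R) ≡ pinsSeq (L ++ a ∷ b ∷ []) ++ pinsSeq (a ∷ b ∷ R)
pinsSeq-++ [] a b R = refl
pinsSeq-++ (x ∷ L) a b R = begin
  pinsSeq (x ∷ L ++ a ∷ b ∷ R)
    ≡⟨ pinsSeq-∷ x (L ++ a ∷ b ∷ R) ⟩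
  pinsSeq (x ∷ take 2 (L ++ a ∷ b ∷ R)) ++ pinsSeq (L ++ a ∷ b ∷ R)
    ≡⟨ cong₂ (λ P Q → pinsSeq (x ∷ P) ++ Q) (take-2-++ L a b R []) (pinsSeq-++ L a b R) ⟩
  pinsSeq (x ∷ take 2 (L ++ a ∷ b ∷ [])) ++ (pinsSeq (L ++ a ∷ b ∷ []) ++ pinsSeq (a ∷ b ∷ R))
    ≡⟨ ++-assoc (pinsSeq (x ∷ take 2 (L ++ a ∷ b ∷ []))) _ _ ⟨
  (pinsSeq (x ∷ take 2 (L ++ a ∷ b ∷ [])) ++ pinsSeq (L ++ a ∷ b ∷ [])) ++ pinsSeq (a ∷ b ∷ R)
    ≡⟨ cong (_++ pinsSeq (a ∷ b ∷ R)) (pinsSeq-∷ x (L ++ a ∷ b ∷ [])) ⟨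
  pinsSeq (x ∷ L ++ a ∷ b ∷ []) ++ pinsSeq (a ∷ b ∷ R) ∎
  where open ≡-Reasoning

pinsSeq-∷ʳ-notPeak : ∀ {v c} xs → ¬ c < v → pinsSeq (xs ++ v ∷ c ∷ []) ≡ pinsSeq (xs ++ v ∷ [])
pinsSeq-∷ʳ-notPeak {v} {c} xs c≮v with initLast xs
... | [] = refl
... | L ∷ʳ′ x = begin
  pinsSeq ((L ∷ʳ x) ++ v ∷ c ∷ [])
    ≡⟨ cong pinsSeq (++-assoc L (x ∷ []) (v ∷ c ∷ [])) ⟩
  pinsSeq (L ++ x ∷ v ∷ c ∷ [])
    ≡⟨ pinsSeq-++ L x v (c ∷ []) ⟩
  pinsSeq (L ++ x ∷ v ∷ []) ++ pinsSeq (x ∷ v ∷ c ∷ [])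
    ≡⟨ cong (pinsSeq (L ++ x ∷ v ∷ []) ++_) (pinsSeq-notPeakʳ [] c≮v) ⟩
  pinsSeq (L ++ x ∷ v ∷ []) ++ []
    ≡⟨ ++-identityʳ _ ⟩
  pinsSeq (L ++ x ∷ v ∷ [])
    ≡⟨ cong pinsSeq (++-assoc L (x ∷ []) (v ∷ [])) ⟨
  pinsSeq ((L ∷ʳ x) ++ v ∷ []) ∎
  where open ≡-Reasoning

pinsSeq-cut : ∀ {l m₁ m₂ r} L W R → m₁ < l → m₂ < r →
  pinsSeq (L ++ l ∷ m₁ ∷ W ++ m₂ ∷ r ∷ R) ≡
  pinsSeq (L ++ l ∷ m₁ ∷ []) ++ pinsSeq (m₁ ∷ W ++ m₂ ∷ []) ++ pinsSeq (m₂ ∷ r ∷ R)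
pinsSeq-cut {l} {m₁} {m₂} {r} L W R m₁<l m₂<r = begin
  pinsSeq (L ++ l ∷ m₁ ∷ W ++ m₂ ∷ r ∷ R)
    ≡⟨ pinsSeq-++ L l m₁ (W ++ m₂ ∷ r ∷ R) ⟩
  pinsSeq (L ++ l ∷ m₁ ∷ []) ++ pinsSeq (l ∷ m₁ ∷ W ++ m₂ ∷ r ∷ R)
    ≡⟨ cong (pinsSeq (L ++ l ∷ m₁ ∷ []) ++_) (trans (pinsSeq-notPeakˡ (W ++ m₂ ∷ r ∷ R) (<-asym m₁<l)) window) ⟩
  pinsSeq (L ++ l ∷ m₁ ∷ []) ++ pinsSeq (m₁ ∷ W ++ m₂ ∷ []) ++ pinsSeq (m₂ ∷ r ∷ R) ∎
  where
  open ≡-Reasoning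
  window : pinsSeq ((m₁ ∷ W) ++ m₂ ∷ r ∷ R) ≡ pinsSeq (m₁ ∷ W ++ m₂ ∷ []) ++ pinsSeq (m₂ ∷ r ∷ R)
  window = trans (pinsSeq-++ (m₁ ∷ W) m₂ r R)
                 (cong (_++ pinsSeq (m₂ ∷ r ∷ R)) (pinsSeq-∷ʳ-notPeak (m₁ ∷ W) (<-asym m₂<r)))

-- Reversal

pinsSeq-reverse-triple : ∀ x y z → pinsSeq (z ∷ y ∷ x ∷ []) ≡ reverse (pinsSeq (x ∷ y ∷ z ∷ []))
pinsSeq-reverse-triple x y z with x <ᵇ y | z <ᵇ y
... | true | true = refl
... | true | false = refl
... | false | true = refl
... | false | false = refl

pinsSeq-reverse : ∀ xs → pinsSeq (reverse xs) ≡ reverse (pinsSeq xs)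
pinsSeq-reverse [] = refl
pinsSeq-reverse (x ∷ []) = refl
pinsSeq-reverse (x ∷ y ∷ []) = refl
pinsSeq-reverse (x ∷ y ∷ z ∷ zs) = begin
  pinsSeq (reverse (x ∷ y ∷ z ∷ zs))
    ≡⟨ cong pinsSeq (reverse-++ (x ∷ y ∷ z ∷ []) zs) ⟩
  pinsSeq (reverse zs ++ z ∷ y ∷ x ∷ [])
    ≡⟨ pinsSeq-++ (reverse zs) z y (x ∷ []) ⟩
  pinsSeq (reverse zs ++ z ∷ y ∷ []) ++ pinsSeq (z ∷ y ∷ x ∷ [])
    ≡⟨ cong (λ P → pinsSeq P ++ pinsSeq (z ∷ y ∷ x ∷ [])) (reverse-++ (y ∷ z ∷ []) zs) ⟨
  pinsSeq (reverse (y ∷ z ∷ zs)) ++ pinsSeq (z ∷ y ∷ x ∷ [])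
    ≡⟨ cong₂ _++_ (pinsSeq-reverse (y ∷ z ∷ zs)) (pinsSeq-reverse-triple x y z) ⟩
  reverse (pinsSeq (y ∷ z ∷ zs)) ++ reverse (pinsSeq (x ∷ y ∷ z ∷ []))
    ≡⟨ reverse-++ (pinsSeq (x ∷ y ∷ z ∷ [])) (pinsSeq (y ∷ z ∷ zs)) ⟨
  reverse (pinsSeq (x ∷ y ∷ z ∷ []) ++ pinsSeq (y ∷ z ∷ zs))
    ≡⟨ cong reverse (pinsSeq-∷ x (y ∷ z ∷ zs)) ⟨
  reverse (pinsSeq (x ∷ y ∷ z ∷ zs)) ∎
  where open ≡-Reasoning

pinsSeq-replace-head : ∀ {a b h} xs → a < h → (h ∈ pinsSeq (a ∷ h ∷ xs) → b < h) →
  pinsSeq (a ∷ h ∷ xs) ≡ pinsSeq (b ∷ h ∷ xs)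
pinsSeq-replace-head [] _ _ = refl
pinsSeq-replace-head {h = h} (z ∷ zs) a<h b<h with z <? h
... | yes z<h = trans (pinsSeq-peak zs a<h z<h) (sym (pinsSeq-peak zs (b<h h∈) z<h))
  where h∈ = subst (h ∈_) (sym (pinsSeq-peak zs a<h z<h)) (here refl)
... | no z≮h = trans (pinsSeq-notPeakʳ zs z≮h) (sym (pinsSeq-notPeakʳ zs z≮h))

pinsSeq-replace-last : ∀ {a b v} xs → b < v → (v ∈ pinsSeq (xs ++ v ∷ b ∷ []) → a < v) →
  pinsSeq (xs ++ v ∷ b ∷ []) ≡ pinsSeq (xs ++ v ∷ a ∷ [])
pinsSeq-replace-last {a} {b} {v} xs b<v a<v with initLast xs
... | [] = refl
... | L ∷ʳ′ x = trans (split b) (trans (cong (pinsSeq (L ++ x ∷ v ∷ []) ++_) last-triple) (sym (split a)))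
  where
  split : ∀ c → pinsSeq ((L ∷ʳ x) ++ v ∷ c ∷ []) ≡ pinsSeq (L ++ x ∷ v ∷ []) ++ pinsSeq (x ∷ v ∷ c ∷ [])
  split c = trans (cong pinsSeq (++-assoc L (x ∷ []) (v ∷ c ∷ []))) (pinsSeq-++ L x v (c ∷ []))
  last-triple : pinsSeq (x ∷ v ∷ b ∷ []) ≡ pinsSeq (x ∷ v ∷ a ∷ [])
  last-triple with x <? v
  ... | yes x<v = trans (pinsSeq-peak [] x<v b<v) (sym (pinsSeq-peak [] x<v (a<v v∈)))
    where v∈ = subst (v ∈_) (sym (split b)) (∈-++⁺ʳ _ (subst (v ∈_) (sym (pinsSeq-peak [] x<v b<v)) (here refl)))
  ... | no x≮v = trans (pinsSeq-notPeakˡ (b ∷ []) x≮v) (sym (pinsSeq-notPeakˡ (a ∷ []) x≮v))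

-- The end entries of a window only decide whether its first and last inner entries are
-- pinnacles, and such pinnacles lie above both ends.
pinsSeq-swap-ends : ∀ {a b} M → (∀ {h K} → M ≡ h ∷ K → a < h) → (∀ {K v} → M ≡ K ∷ʳ v → b < v) →
  (∀ {x} → x ∈ pinsSeq (a ∷ M ++ b ∷ []) → a < x × b < x) →
  pinsSeq (a ∷ M ++ b ∷ []) ≡ pinsSeq (b ∷ M ++ a ∷ [])
pinsSeq-swap-ends {a} {b} M a<head b<last above with initLast M
... | [] = refl
... | [] ∷ʳ′ v =
  trans (pinsSeq-peak [] (a<head refl) (b<last {[]} refl)) (sym (pinsSeq-peak [] (b<last {[]} refl) (a<head refl)))
... | (h ∷ K) ∷ʳ′ v = begin
  pinsSeq (a ∷ h ∷ (K ∷ʳ v) ++ b ∷ [])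
    ≡⟨ head-replaced ⟩
  pinsSeq (b ∷ h ∷ (K ∷ʳ v) ++ b ∷ [])
    ≡⟨ reassoc b ⟩
  pinsSeq ((b ∷ h ∷ K) ++ v ∷ b ∷ [])
    ≡⟨ pinsSeq-replace-last (b ∷ h ∷ K) (b<last {h ∷ K} refl) (λ v∈ → proj₁ (above (back v∈))) ⟩
  pinsSeq ((b ∷ h ∷ K) ++ v ∷ a ∷ [])
    ≡⟨ reassoc a ⟨
  pinsSeq (b ∷ h ∷ (K ∷ʳ v) ++ a ∷ []) ∎
  where
  open ≡-Reasoning
  reassoc : ∀ c → pinsSeq (b ∷ h ∷ (K ∷ʳ v) ++ c ∷ []) ≡ pinsSeq ((b ∷ h ∷ K) ++ v ∷ c ∷ [])
  reassoc c = cong (λ X → pinsSeq (b ∷ h ∷ X)) (++-assoc K (v ∷ []) (c ∷ []))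
  head-replaced : pinsSeq (a ∷ h ∷ (K ∷ʳ v) ++ b ∷ []) ≡ pinsSeq (b ∷ h ∷ (K ∷ʳ v) ++ b ∷ [])
  head-replaced = pinsSeq-replace-head ((K ∷ʳ v) ++ b ∷ []) (a<head refl) (λ h∈ → proj₂ (above h∈))
  back : ∀ {x} → x ∈ pinsSeq ((b ∷ h ∷ K) ++ v ∷ b ∷ []) → x ∈ pinsSeq (a ∷ h ∷ (K ∷ʳ v) ++ b ∷ [])
  back {x} = subst (x ∈_) (sym (trans head-replaced (reassoc b)))

pinsSeq-reverse-window : ∀ {a b} M → (∀ {h K} → M ≡ h ∷ K → a < h) → (∀ {K v} → M ≡ K ∷ʳ v → b < v) →
  (∀ {x} → x ∈ pinsSeq (a ∷ M ++ b ∷ []) → a < x × b < x) →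
  pinsSeq (a ∷ reverse M ++ b ∷ []) ≡ reverse (pinsSeq (a ∷ M ++ b ∷ []))
pinsSeq-reverse-window {a} {b} M a<head b<last above = begin
  pinsSeq (a ∷ reverse M ++ b ∷ [])
    ≡⟨ cong pinsSeq (trans (reverse-++ (b ∷ M) (a ∷ [])) (cong (a ∷_) (unfold-reverse b M))) ⟨
  pinsSeq (reverse (b ∷ M ++ a ∷ []))
    ≡⟨ pinsSeq-reverse (b ∷ M ++ a ∷ []) ⟩
  reverse (pinsSeq (b ∷ M ++ a ∷ []))
    ≡⟨ cong reverse (pinsSeq-swap-ends M a<head b<last above) ⟨
  reverse (pinsSeq (a ∷ M ++ b ∷ [])) ∎
  where open ≡-Reasoning

at-++ˡ : ∀ A X s → s ≤ length A → at (A ++ X) s ≡ at A s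
at-++ˡ A X zero _ = refl
at-++ˡ (a ∷ A) X (suc zero) _ = refl
at-++ˡ (a ∷ A) X (suc (suc s)) (s≤s s≤) = at-++ˡ A X (suc s) s≤

at-++ʳ : ∀ A X s → length A < s → at (A ++ X) s ≡ at X (s ∸ length A)
at-++ʳ [] X s _ = refl
at-++ʳ (a ∷ A) X (suc (suc s)) (s≤s A<s) = at-++ʳ A X (suc s) A<s

at-++-∷ : ∀ A x X → at (A ++ x ∷ X) (suc (length A)) ≡ just x
at-++-∷ [] x X = refl
at-++-∷ (a ∷ A) x X = at-++-∷ A x X

at⇒∈ : ∀ xs i {x} → at xs i ≡ just x → x ∈ xs
at⇒∈ (a ∷ xs) (suc zero) refl = here refl
at⇒∈ (a ∷ xs) (suc (suc i)) eq = there (at⇒∈ xs (suc i) eq)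

at⇒≤length : ∀ xs i {x} → at xs i ≡ just x → i ≤ length xs
at⇒≤length (a ∷ xs) (suc zero) _ = s≤s z≤n
at⇒≤length (a ∷ xs) (suc (suc i)) eq = s≤s (at⇒≤length xs (suc i) eq)

∈⇒at : ∀ {x} xs → x ∈ xs → Σ ℕ λ i → i < length xs × at xs (suc i) ≡ just x
∈⇒at (a ∷ xs) (here refl) = zero , s≤s z≤n , refl
∈⇒at (a ∷ xs) (there x∈) with ∈⇒at xs x∈
... | i , i< , eq = suc i , s≤s i< , eq

length-∷ʳ : ∀ xs (x : ℕ) → length (xs ∷ʳ x) ≡ suc (length xs)
length-∷ʳ xs x = trans (length-++ xs) (+-comm (length xs) 1)

-- Valleys

EndsAscending : List ℕ → Set
EndsAscending (x ∷ y ∷ []) = x < y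
EndsAscending (_ ∷ y ∷ z ∷ zs) = EndsAscending (y ∷ z ∷ zs)
EndsAscending _ = ⊥

EndsAscending-drop : ∀ {a b c R} L → EndsAscending (L ++ a ∷ b ∷ c ∷ R) → EndsAscending (b ∷ c ∷ R)
EndsAscending-drop [] asc = asc
EndsAscending-drop (x ∷ []) asc = asc
EndsAscending-drop {a} {b} {c} {R} (x ∷ y ∷ []) asc = EndsAscending-drop {a} {b} {c} {R} (y ∷ []) asc
EndsAscending-drop {a} {b} {c} {R} (x ∷ y ∷ z ∷ L) asc = EndsAscending-drop {a} {b} {c} {R} (y ∷ z ∷ L) asc

Linked-drop : ∀ L {ys : List ℕ} → Linked _≢_ (L ++ ys) → Linked _≢_ ys
Linked-drop [] distinct = distinct
Linked-drop (x ∷ L) distinct = Linked-drop L (Linked.tail distinct)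

record ValleyBelow (p : ℕ) (P xs : List ℕ) : Set where
  field
    L : List ℕ
    l m r : ℕ
    R : List ℕ
    xs≡ : xs ≡ L ++ l ∷ m ∷ r ∷ R
    m<l : m < l
    m<r : m < r
    m<p : m < p
    pins-before : pinsSeq (L ++ l ∷ m ∷ []) ≡ P

  suffix : List ℕ
  suffix = m ∷ r ∷ R

  suffix-pins : List ℕ
  suffix-pins = pinsSeq suffix

  pins-split : pinsSeq xs ≡ P ++ suffix-pins
  pins-split = begin
    pinsSeq xs                                            ≡⟨ cong pinsSeq xs≡ ⟩
    pinsSeq (L ++ l ∷ m ∷ r ∷ R)                          ≡⟨ pinsSeq-++ L l m (r ∷ R) ⟩
    pinsSeq (L ++ l ∷ m ∷ []) ++ pinsSeq (l ∷ m ∷ r ∷ R)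
      ≡⟨ cong₂ _++_ pins-before (pinsSeq-notPeakˡ (r ∷ R) (<-asym m<l)) ⟩
    P ++ suffix-pins                                      ∎
    where open ≡-Reasoning

  suffix-distinct : Linked _≢_ xs → Linked _≢_ suffix
  suffix-distinct distinct =
    Linked-drop (L ∷ʳ l) (subst (Linked _≢_) (trans xs≡ (sym (++-assoc L (l ∷ []) suffix))) distinct)

  suffix-ascending : EndsAscending xs → EndsAscending suffix
  suffix-ascending asc = EndsAscending-drop L (subst EndsAscending xs≡ asc)

ValleyBelow-∷ : ∀ {p P T x y z zs} → pinsSeq (x ∷ y ∷ z ∷ []) ≡ T →
  ValleyBelow p P (y ∷ z ∷ zs) → ValleyBelow p (T ++ P) (x ∷ y ∷ z ∷ zs)
ValleyBelow-∷ {P = P} {T} {x} {y} {z} front V =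
  record { ValleyBelow V hiding (L; xs≡; pins-before) ; L = x ∷ L ; xs≡ = cong (x ∷_) xs≡ ; pins-before = pins-before′ }
  where
  open ValleyBelow V
  pins-before′ : pinsSeq (x ∷ L ++ l ∷ m ∷ []) ≡ T ++ P
  pins-before′ = begin
    pinsSeq (x ∷ L ++ l ∷ m ∷ [])
      ≡⟨ pinsSeq-∷ x (L ++ l ∷ m ∷ []) ⟩
    pinsSeq (x ∷ take 2 (L ++ l ∷ m ∷ [])) ++ pinsSeq (L ++ l ∷ m ∷ [])
      ≡⟨ cong₂ (λ X Y → pinsSeq (x ∷ X) ++ Y)
               (trans (take-2-++ L l m [] (r ∷ R)) (cong (take 2) (sym xs≡))) pins-before ⟩
    pinsSeq (x ∷ y ∷ z ∷ []) ++ P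
      ≡⟨ cong (_++ P) front ⟩
    T ++ P ∎
    where open ≡-Reasoning

descent-valley : ∀ {y z} zs → z < y → Linked _≢_ (y ∷ z ∷ zs) → EndsAscending (y ∷ z ∷ zs) →
  ValleyBelow y [] (y ∷ z ∷ zs)
descent-valley [] z<y _ y<z = ⊥-elim (<-asym z<y y<z)
descent-valley {y} {z} (w ∷ ws) z<y (_ ∷ z≢w ∷ distinct) asc with <-cmp z w
... | tri< z<w _ _ = record
  { L = [] ; l = y ; m = z ; r = w ; R = ws ; xs≡ = refl
  ; m<l = z<y ; m<r = z<w ; m<p = z<y ; pins-before = refl }
... | tri≈ _ z≡w _ = ⊥-elim (z≢w z≡w)
... | tri> _ _ w<z = record { ValleyBelow V hiding (m<p) ; m<p = <-trans (ValleyBelow.m<p V) z<y }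
  where
  V : ValleyBelow z [] (y ∷ z ∷ w ∷ ws)
  V = ValleyBelow-∷ (pinsSeq-notPeakˡ (w ∷ []) (<-asym z<y)) (descent-valley ws w<z (z≢w ∷ distinct) asc)

-- A valley with exactly j + 1 pinnacles before it, the last of which lies above it.
ValleyAfter : List ℕ → ℕ → Set
ValleyAfter xs j = ∃₂ λ Q p → length Q ≡ j × ValleyBelow p (Q ∷ʳ p) xs

valley-after-peak : ∀ {x y z zs} → x < y → z < y → Linked _≢_ (y ∷ z ∷ zs) → EndsAscending (y ∷ z ∷ zs) →
  (∀ j → j < length (pinsSeq (y ∷ z ∷ zs)) → ValleyAfter (y ∷ z ∷ zs) j) →
  ∀ j → j < length (pinsSeq (x ∷ y ∷ z ∷ zs)) → ValleyAfter (x ∷ y ∷ z ∷ zs) j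
valley-after-peak {zs = zs} x<y z<y distinct asc _ zero _ =
  [] , _ , refl , ValleyBelow-∷ (pinsSeq-peak [] x<y z<y) (descent-valley zs z<y distinct asc)
valley-after-peak {zs = zs} x<y z<y _ _ valley-after-tail (suc j) j<
  with valley-after-tail j (≤-pred (subst (λ P → suc j < length P) (pinsSeq-peak zs x<y z<y) j<))
... | Q , p , |Q|≡j , V = _ ∷ Q , p , cong suc |Q|≡j , ValleyBelow-∷ {zs = zs} (pinsSeq-peak [] x<y z<y) V

valley-after : ∀ xs → Linked _≢_ xs → EndsAscending xs → ∀ j → j < length (pinsSeq xs) → ValleyAfter xs j
valley-after (x ∷ y ∷ z ∷ zs) (_ ∷ distinct) asc
  with valley-after (y ∷ z ∷ zs) distinct asc | x <? y ×-dec z <? y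
... | valley-after-tail | yes (x<y , z<y) = valley-after-peak x<y z<y distinct asc valley-after-tail
... | valley-after-tail | no ¬peak = λ j j< →
  let Q , p , |Q|≡j , V = valley-after-tail j (subst (λ P → j < length P) (pinsSeq-notPeak zs ¬peak) j<)
  in Q , p , |Q|≡j , ValleyBelow-∷ (pinsSeq-notPeak [] ¬peak) V

valley-prefix-after-ascent : ∀ {p P m r R} (V : ValleyBelow p P (m ∷ r ∷ R)) → m < r →
  ∃ λ K → ValleyBelow.L V ≡ m ∷ K
valley-prefix-after-ascent V m<r with ValleyBelow.L V | ValleyBelow.xs≡ V
... | [] | eq = ⊥-elim (<-asym m<r r<m)
  where r<m = subst₂ _<_ (sym (∷-injectiveˡ (∷-injectiveʳ eq))) (sym (∷-injectiveˡ eq)) (ValleyBelow.m<l V)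
... | c ∷ K | eq = K , cong (_∷ K) (sym (∷-injectiveˡ eq))

valley-at : ∀ {i y} xs → Linked _≢_ xs → EndsAscending xs → at (pinsSeq xs) i ≡ just y →
  Σ (List ℕ) λ Q → suc (length Q) ≡ i × ValleyBelow y (Q ∷ʳ y) xs
valley-at {zero} _ _ _ ()
valley-at {suc d} {y} xs distinct asc at-y with valley-after xs distinct asc d (at⇒≤length (pinsSeq xs) (suc d) at-y)
... | Q , p , refl , V = Q , refl , subst (λ p → ValleyBelow p (Q ∷ʳ p) xs) p≡y V
  where
  open ValleyBelow V using (suffix-pins; pins-split)
  p≡y : p ≡ y
  p≡y = just-injective (begin
    just p                                      ≡⟨ at-++-∷ Q p suffix-pins ⟨
    at (Q ++ p ∷ suffix-pins) (suc (length Q))  ≡⟨ cong (λ P → at P (suc (length Q))) (++-assoc Q (p ∷ []) suffix-pins) ⟨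
    at ((Q ∷ʳ p) ++ suffix-pins) (suc (length Q)) ≡⟨ cong (λ P → at P (suc (length Q))) pins-split ⟨
    at (pinsSeq xs) (suc (length Q))            ≡⟨ at-y ⟩
    just y                                      ∎)
    where open ≡-Reasoning

-- Counting the pinnacles below y

FirstSmallest : ℕ → List ℕ → Set
FirstSmallest k P = (i j yi yj : ℕ) → 1 ≤ i → i ≤ k → k < j → at P i ≡ just yi → at P j ≡ just yj → yi < yj

FirstSmallest⇒below : ∀ {k P} A S → P ≡ A ++ S → length A ≡ k → FirstSmallest k P →
  ∀ {a s} → a ∈ A → s ∈ S → a < s
FirstSmallest⇒below A S refl refl first-smallest a∈ s∈ with ∈⇒at A a∈ | ∈⇒at S s∈
... | i , i< , at-i | j , _ , at-j =
  first-smallest (suc i) (length A + suc j) _ _ (s≤s z≤n) i< A<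
    (trans (at-++ˡ A S (suc i) i<) at-i)
    (trans (at-++ʳ A S (length A + suc j) A<) (trans (cong (at S) (m+n∸m≡n (length A) (suc j))) at-j))
  where A< = m<m+n (length A) (s≤s z≤n)

below-threshold : ∀ {y} A S → (∀ {a s} → a ∈ A → s ∈ S → a < s) → y ∈ A ++ S →
  length (filter (_<? y) (A ++ S)) ≡ length A → All (_< y) A × All (λ s → ¬ s < y) S
below-threshold {y} A S A<S y∈ count = A<y , S≮y
  where
  #below : List ℕ → ℕ
  #below xs = length (filter (_<? y) xs)

  #below-++ : #below (A ++ S) ≡ #below A + #below S
  #below-++ = trans (cong length (filter-++ (_<? y) A S)) (length-++ (filter (_<? y) A))

  y∉A : ¬ y ∈ A
  y∉A y∈A = <-irrefl count (begin-strict
    #below (A ++ S)        ≡⟨ #below-++ ⟩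
    #below A + #below S    ≡⟨ cong (λ n → #below A + length n) (filter-none (_<? y) S≮y′) ⟩
    #below A + 0           ≡⟨ +-identityʳ _ ⟩
    #below A               <⟨ filter-notAll (_<? y) A (Any.map (λ { refl → <-irrefl refl }) y∈A) ⟩
    length A               ∎)
    where
    open ≤-Reasoning
    S≮y′ : All (λ s → ¬ s < y) S
    S≮y′ = All.tabulate (λ s∈ s<y → <-asym s<y (A<S y∈A s∈))

  y∈S : y ∈ S
  y∈S with ∈-++⁻ A y∈
  ... | inj₁ y∈A = ⊥-elim (y∉A y∈A)
  ... | inj₂ y∈S = y∈S

  A<y : All (_< y) A
  A<y = All.tabulate (λ a∈ → A<S a∈ y∈S)

  #below-S : #below S ≡ 0
  #below-S = +-cancelˡ-≡ (length A) _ _ (begin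
    length A + #below S    ≡⟨ cong (_+ #below S) (cong length (filter-all (_<? y) A<y)) ⟨
    #below A + #below S    ≡⟨ #below-++ ⟨
    #below (A ++ S)        ≡⟨ count ⟩
    length A               ≡⟨ +-identityʳ (length A) ⟨
    length A + 0           ∎)
    where open ≡-Reasoning

  S≮y : All (λ s → ¬ s < y) S
  S≮y = All.tabulate (λ s∈ s<y → <-irrefl (sym #below-S) (filter-some (_<? y) (lose s∈ s<y)))

split-at-threshold : ∀ {k t y} P A S → P ≡ A ++ S → length A ≡ k → FirstSmallest k P →
  at P t ≡ just y → length (filter (_<? y) P) ≡ k → length A < t × All (_< y) A × All (λ s → ¬ s < y) S
split-at-threshold {t = t} P A S refl refl first-smallest at-t count = A<t , A<y , S≮y
  where
  below = below-threshold A S (FirstSmallest⇒below A S refl refl first-smallest) (at⇒∈ P t at-t) count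
  A<y = proj₁ below
  S≮y = proj₂ below
  A<t : length A < t
  A<t = ≰⇒> (λ t≤k → <-irrefl refl (All.lookup A<y (at⇒∈ A t (trans (sym (at-++ˡ A S t t≤k)) at-t))))

-- Moving a pinnacle by a reversal

PinnacleMove : ℕ → ℕ → ℕ → List ℕ → List ℕ → Set
PinnacleMove k t y P P′ =
  ((x : ℕ) → (x ∈ P) ⇔ (x ∈ P′)) ×
  at P′ (suc k) ≡ just y ×
  ((s : ℕ) → 1 ≤ s → s ≤ k → at P′ s ≡ at P s) ×
  ((s : ℕ) → t < s → s ≤ length P → at P′ s ≡ at P s)

reverse-block-move : ∀ A Q y C →
  PinnacleMove (length A) (length A + suc (length Q)) y (A ++ (Q ∷ʳ y) ++ C) (A ++ reverse (Q ∷ʳ y) ++ C)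
reverse-block-move A Q y C = same-entries , moved , prefix , suffix
  where
  B = Q ∷ʳ y

  perm : A ++ B ++ C ↭ A ++ reverse B ++ C
  perm = ++⁺ˡ A (++⁺ʳ C (↭-sym (↭-reverse B)))

  same-entries : (x : ℕ) → (x ∈ A ++ B ++ C) ⇔ (x ∈ A ++ reverse B ++ C)
  same-entries x = mk⇔ (∈-resp-↭ perm) (∈-resp-↭ (↭-sym perm))

  moved : at (A ++ reverse B ++ C) (suc (length A)) ≡ just y
  moved = subst (λ R → at (A ++ R ++ C) (suc (length A)) ≡ just y)
                (sym (reverse-++ Q (y ∷ []))) (at-++-∷ A y (reverse Q ++ C))

  prefix : (s : ℕ) → 1 ≤ s → s ≤ length A → at (A ++ reverse B ++ C) s ≡ at (A ++ B ++ C) s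
  prefix s _ s≤ = trans (at-++ˡ A _ s s≤) (sym (at-++ˡ A _ s s≤))

  |A++B| : length (A ++ B) ≡ length A + suc (length Q)
  |A++B| = trans (length-++ A) (cong (length A +_) (length-∷ʳ Q y))

  |A++revB| : length (A ++ reverse B) ≡ length (A ++ B)
  |A++revB| = trans (length-++ A) (trans (cong (length A +_) (length-reverse B)) (sym (length-++ A)))

  after : ∀ R s → length (A ++ R) < s → at (A ++ R ++ C) s ≡ at C (s ∸ length (A ++ R))
  after R s A++R< = trans (cong (λ X → at X s) (sym (++-assoc A R C))) (at-++ʳ (A ++ R) C s A++R<)

  suffix : (s : ℕ) → length A + suc (length Q) < s → s ≤ length (A ++ B ++ C) →
    at (A ++ reverse B ++ C) s ≡ at (A ++ B ++ C) s
  suffix s t<s _ = begin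
    at (A ++ reverse B ++ C) s          ≡⟨ after (reverse B) s (subst (_< s) (sym (trans |A++revB| |A++B|)) t<s) ⟩
    at C (s ∸ length (A ++ reverse B))  ≡⟨ cong (λ n → at C (s ∸ n)) |A++revB| ⟩
    at C (s ∸ length (A ++ B))          ≡⟨ after B s (subst (_< s) (sym |A++B|) t<s) ⟨
    at (A ++ B ++ C) s                  ∎
    where open ≡-Reasoning

pinnacle-move-between-valleys : ∀ {l m₁ m₂ r y} L M R A Q → m₁ < l → m₂ < r →
  (∀ {h K} → M ≡ h ∷ K → m₁ < h) → (∀ {K v} → M ≡ K ∷ʳ v → m₂ < v) →
  (∀ {x} → x ∈ pinsSeq (m₁ ∷ M ++ m₂ ∷ []) → m₁ < x × m₂ < x) →
  pinsSeq (L ++ l ∷ m₁ ∷ []) ≡ A → pinsSeq (m₁ ∷ M ++ m₂ ∷ []) ≡ Q ∷ʳ y →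
  PinnacleMove (length A) (length A + suc (length Q)) y
    (pinsSeq ((L ++ l ∷ m₁ ∷ []) ++ M ++ m₂ ∷ r ∷ R)) (pinsSeq ((L ++ l ∷ m₁ ∷ []) ++ reverse M ++ m₂ ∷ r ∷ R))
pinnacle-move-between-valleys {l} {m₁} {m₂} {r} {y} L M R A Q m₁<l m₂<r m₁<head m₂<last above A≡ B≡ =
  subst₂ (PinnacleMove _ _ y) (sym (around M B≡)) (sym (around (reverse M) reversed-B≡)) (reverse-block-move A Q y C)
  where
  C = pinsSeq (m₂ ∷ r ∷ R)

  around : ∀ W {B} → pinsSeq (m₁ ∷ W ++ m₂ ∷ []) ≡ B →
    pinsSeq ((L ++ l ∷ m₁ ∷ []) ++ W ++ m₂ ∷ r ∷ R) ≡ A ++ B ++ C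
  around W B≡ = trans (cong pinsSeq (++-assoc L (l ∷ m₁ ∷ []) _))
                      (trans (pinsSeq-cut L W R m₁<l m₂<r) (cong₂ (λ A B → A ++ B ++ C) A≡ B≡))

  reversed-B≡ : pinsSeq (m₁ ∷ reverse M ++ m₂ ∷ []) ≡ reverse (Q ∷ʳ y)
  reversed-B≡ = trans (pinsSeq-reverse-window M m₁<head m₂<last above) (cong reverse B≡)

record InnerReversal (k t y : ℕ) (xs : List ℕ) : Set where
  field
    V M W : List ℕ
    V≢[] : V ≢ []
    M≢[] : M ≢ []
    W≢[] : W ≢ []
    xs≡ : xs ≡ V ++ M ++ W
    move : PinnacleMove k t y (pinsSeq xs) (pinsSeq (V ++ reverse M ++ W))

reverse-between-valleys : ∀ {p₁ A p₂ Q y xs}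
  (V₁ : ValleyBelow p₁ A xs) (V₂ : ValleyBelow p₂ (Q ∷ʳ y) (ValleyBelow.suffix V₁)) →
  (∀ {x} → x ∈ Q ∷ʳ y → ValleyBelow.m V₁ < x × ValleyBelow.m V₂ < x) →
  InnerReversal (length A) (length A + suc (length Q)) y xs
reverse-between-valleys {A = A} {Q = Q} {y} {xs} V₁ V₂ above
  with valley-prefix-after-ascent V₂ (ValleyBelow.m<r V₁)
... | K , L₂≡ = record
  { V = V ; M = M ; W = W
  ; V≢[] = λ V≡[] → case ++-conicalʳ L₁ _ V≡[] of λ ()
  ; M≢[] = λ M≡[] → case ++-conicalʳ K _ M≡[] of λ ()
  ; W≢[] = λ ()
  ; xs≡ = xs≡′
  ; move = subst (λ X → PinnacleMove _ _ y (pinsSeq X) (pinsSeq (V ++ reverse M ++ W))) (sym xs≡′)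
      (pinnacle-move-between-valleys L₁ M R₂ A Q m<l₁ m<r₂ m₁<head m₂<last
        (λ x∈ → above (subst (_ ∈_) window≡ x∈)) pins-before₁ window≡) }
  where
  open ValleyBelow V₁ using () renaming (L to L₁; l to l₁; m to m₁; r to r₁; R to R₁;
    m<l to m<l₁; m<r to m<r₁; xs≡ to xs≡₁; pins-before to pins-before₁)
  open ValleyBelow V₂ using () renaming (L to L₂; l to l₂; m to m₂; r to r₂; R to R₂;
    m<l to m<l₂; m<r to m<r₂; xs≡ to xs≡₂; pins-before to pins-before₂)
  V = L₁ ++ l₁ ∷ m₁ ∷ []
  M = K ∷ʳ l₂
  W = m₂ ∷ r₂ ∷ R₂

  between≡ : r₁ ∷ R₁ ≡ M ++ W
  between≡ = trans (∷-injectiveʳ (trans xs≡₂ (cong (_++ l₂ ∷ W) L₂≡))) (sym (++-assoc K (l₂ ∷ []) W))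

  xs≡′ : xs ≡ V ++ M ++ W
  xs≡′ = trans xs≡₁ (trans (cong (λ X → L₁ ++ l₁ ∷ m₁ ∷ X) between≡)
                           (sym (++-assoc L₁ (l₁ ∷ m₁ ∷ []) (M ++ W))))

  window≡ : pinsSeq (m₁ ∷ M ++ m₂ ∷ []) ≡ Q ∷ʳ y
  window≡ = trans (cong (λ X → pinsSeq (m₁ ∷ X)) (++-assoc K (l₂ ∷ []) (m₂ ∷ [])))
                  (trans (cong (λ L → pinsSeq (L ++ l₂ ∷ m₂ ∷ [])) (sym L₂≡)) pins-before₂)

  m₁<head : ∀ {h K′} → M ≡ h ∷ K′ → m₁ < h
  m₁<head M≡ = subst (m₁ <_) (∷-injectiveˡ (trans between≡ (cong (_++ W) M≡))) m<r₁

  m₂<last : ∀ {K′ v} → M ≡ K′ ∷ʳ v → m₂ < v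
  m₂<last {K′} M≡ = subst (m₂ <_) (∷ʳ-injectiveʳ K K′ M≡) m<l₂

reversal-after-valley : ∀ {p₁ Q₁ xs t y} (V₁ : ValleyBelow p₁ (Q₁ ∷ʳ p₁) xs) →
  Linked _≢_ xs → EndsAscending xs →
  length (Q₁ ∷ʳ p₁) < t → All (_< y) (Q₁ ∷ʳ p₁) → All (λ s → ¬ s < y) (ValleyBelow.suffix-pins V₁) →
  at (pinsSeq xs) t ≡ just y → InnerReversal (length (Q₁ ∷ʳ p₁)) t y xs
reversal-after-valley {p₁} {Q₁} {xs} {t} {y} V₁ distinct asc A<t A<y S≮y at-t
  with valley-at (suffix V₁) (suffix-distinct V₁ distinct) (suffix-ascending V₁ asc) at-S
  where
  open ValleyBelow
  at-S : at (suffix-pins V₁) (t ∸ length (Q₁ ∷ʳ p₁)) ≡ just y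
  at-S = trans (sym (trans (cong (λ P → at P t) (pins-split V₁)) (at-++ʳ (Q₁ ∷ʳ p₁) _ t A<t))) at-t
... | Q₂ , |Q₂| , V₂ = subst (λ t → InnerReversal _ t y xs) t≡ (reverse-between-valleys V₁ V₂ above)
  where
  t≡ : length (Q₁ ∷ʳ p₁) + suc (length Q₂) ≡ t
  t≡ = trans (cong (length (Q₁ ∷ʳ p₁) +_) |Q₂|) (m+[n∸m]≡n (<⇒≤ A<t))
  above : ∀ {x} → x ∈ Q₂ ∷ʳ y → ValleyBelow.m V₁ < x × ValleyBelow.m V₂ < x
  above {x} x∈ = <-≤-trans m₁<y y≤x , <-≤-trans (ValleyBelow.m<p V₂) y≤x
    where
    y≤x = ≮⇒≥ (All.lookup S≮y (subst (x ∈_) (sym (ValleyBelow.pins-split V₂)) (∈-++⁺ˡ x∈)))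
    m₁<y = <-trans (ValleyBelow.m<p V₁) (All.lookup A<y (∈-++⁺ʳ Q₁ (here refl)))

inner-reversal : ∀ xs k t y → Linked _≢_ xs → EndsAscending xs → 1 ≤ k → k ≤ length (pinsSeq xs) →
  FirstSmallest k (pinsSeq xs) → at (pinsSeq xs) t ≡ just y → length (filter (_<? y) (pinsSeq xs)) ≡ k →
  InnerReversal k t y xs
inner-reversal xs (suc k) t y distinct asc _ k< first-smallest at-t count
  with valley-after xs distinct asc k k<
... | Q₁ , p₁ , refl , V₁
  with split-at-threshold (pinsSeq xs) (Q₁ ∷ʳ p₁) _ (ValleyBelow.pins-split V₁) (length-∷ʳ Q₁ p₁)
                          first-smallest at-t count
... | A<t , A<y , S≮y =
  subst (λ k → InnerReversal k t y xs) (length-∷ʳ Q₁ p₁) (reversal-after-valley V₁ distinct asc A<t A<y S≮y at-t)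

-- The extended permutation

ext-↭ : ∀ {n π} → π ↭ applyUpTo suc n → ext n π ↭ applyUpTo suc (2 + n)
ext-↭ {n} {π} π↭ = ↭-trans (↭-sym (shift (n + 1) π ((n + 2) ∷ [])))
  (↭-trans (++⁺ʳ ((n + 1) ∷ (n + 2) ∷ []) π↭) (↭-reflexive (begin
    applyUpTo suc n ++ (n + 1) ∷ (n + 2) ∷ []
      ≡⟨ cong₂ (λ a b → applyUpTo suc n ++ a ∷ b ∷ []) (+-comm n 1) (+-comm n 2) ⟩
    applyUpTo suc n ++ suc n ∷ suc (suc n) ∷ []   ≡⟨ ++-assoc (applyUpTo suc n) (suc n ∷ []) (suc (suc n) ∷ []) ⟨
    (applyUpTo suc n ∷ʳ suc n) ∷ʳ suc (suc n)     ≡⟨ cong (_∷ʳ suc (suc n)) (applyUpTo-∷ʳ suc n) ⟩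
    applyUpTo suc (suc n) ∷ʳ suc (suc n)          ≡⟨ applyUpTo-∷ʳ suc (suc n) ⟩
    applyUpTo suc (2 + n)                         ∎)))
  where open ≡-Reasoning

ext-distinct : ∀ {n π} → π ↭ applyUpTo suc n → Linked _≢_ (ext n π)
ext-distinct {n} π↭ = AllPairs⇒Linked (Unique-resp-↭ (↭⇒↭ₛ (↭-sym (ext-↭ π↭))) distinct-upTo)
  where
  distinct-upTo : Unique (applyUpTo suc (2 + n))
  distinct-upTo = Unique.applyUpTo⁺₁ suc (2 + n) (λ i<j _ i≡j → <-irrefl (suc-injective i≡j) i<j)

EndsAscending-∷ʳ : ∀ {z} x xs → All (_< z) (x ∷ xs) → EndsAscending (x ∷ xs ∷ʳ z)
EndsAscending-∷ʳ x [] (x<z All.∷ _) = x<z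
EndsAscending-∷ʳ x (y ∷ []) (_ All.∷ xs<z) = EndsAscending-∷ʳ y [] xs<z
EndsAscending-∷ʳ x (y ∷ w ∷ ws) (_ All.∷ xs<z) = EndsAscending-∷ʳ y (w ∷ ws) xs<z

ext-ascending : ∀ {n π} → π ↭ applyUpTo suc n → EndsAscending (ext n π)
ext-ascending {n} {π} π↭ = EndsAscending-∷ʳ (n + 1) π (+-monoʳ-< n (s≤s (s≤s z≤n)) All.∷ All.tabulate π<n+2)
  where
  π<n+2 : ∀ {x} → x ∈ π → x < n + 2
  π<n+2 x∈ with ∈-applyUpTo⁻ suc (∈-resp-↭ π↭ x∈)
  ... | i , i<n , refl = ≤-<-trans i<n (m<m+n n (s≤s z≤n))

take-length-++ : ∀ (M G : List ℕ) → take (length M) (M ++ G) ≡ M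
take-length-++ [] G = refl
take-length-++ (x ∷ M) G = cong (x ∷_) (take-length-++ M G)

drop-length-++ : ∀ (M G : List ℕ) → drop (length M) (M ++ G) ≡ G
drop-length-++ [] G = refl
drop-length-++ (x ∷ M) G = drop-length-++ M G

revAt-++ : ∀ U M G → revAt (suc (length U)) (length U + length M) (U ++ M ++ G) ≡ U ++ reverse M ++ G
revAt-++ [] M G = cong₂ (λ X Y → reverse X ++ Y) (take-length-++ M G) (drop-length-++ M G)
revAt-++ (u ∷ U) M G = cong (u ∷_) (revAt-++ U M G)

reverse-inside-ext : ∀ {n} π V M W → ext n π ≡ V ++ M ++ W → V ≢ [] → M ≢ [] → W ≢ [] →
  ∃₂ λ a b → 1 ≤ a × a ≤ b × b ≤ length π × ext n (revAt a b π) ≡ V ++ reverse M ++ W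
reverse-inside-ext π [] M W _ V≢[] _ _ = ⊥-elim (V≢[] refl)
reverse-inside-ext π (v ∷ U) [] W _ _ M≢[] _ = ⊥-elim (M≢[] refl)
reverse-inside-ext {n} π (v ∷ U) (h ∷ M) W ext≡ _ _ W≢[] with initLast W
... | [] = ⊥-elim (W≢[] refl)
... | G ∷ʳ′ w = a , b , s≤s z≤n , a≤b , b≤ , ext-rev
  where
  a b : ℕ
  a = suc (length U)
  b = length U + suc (length M)

  inner : π ∷ʳ (n + 2) ≡ (U ++ (h ∷ M) ++ G) ∷ʳ w
  inner = trans (∷-injectiveʳ ext≡)
                (trans (cong (U ++_) (sym (++-assoc (h ∷ M) G (w ∷ [])))) (sym (++-assoc U _ (w ∷ []))))

  π≡ : π ≡ U ++ (h ∷ M) ++ G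
  π≡ = proj₁ (∷ʳ-injective π _ inner)

  a≤b : a ≤ b
  a≤b = subst (a ≤_) (sym (+-suc (length U) (length M))) (s≤s (m≤m+n (length U) (length M)))

  b≤ : b ≤ length π
  b≤ = subst (b ≤_) (sym |π|) (+-monoʳ-≤ (length U) (m≤m+n (suc (length M)) (length G)))
    where |π| = trans (cong length π≡) (trans (length-++ U) (cong (length U +_) (length-++ (h ∷ M))))

  ext-rev : ext n (revAt a b π) ≡ (v ∷ U) ++ reverse (h ∷ M) ++ G ∷ʳ w
  ext-rev = begin
    (n + 1) ∷ revAt a b π ∷ʳ (n + 2)
      ≡⟨ cong (λ X → (n + 1) ∷ X ∷ʳ (n + 2)) (trans (cong (revAt a b) π≡) (revAt-++ U (h ∷ M) G)) ⟩
    (n + 1) ∷ (U ++ reverse (h ∷ M) ++ G) ∷ʳ (n + 2)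
      ≡⟨ cong₂ (λ a b → a ∷ (U ++ reverse (h ∷ M) ++ G) ∷ʳ b) (∷-injectiveˡ ext≡) (proj₂ (∷ʳ-injective π _ inner)) ⟩
    v ∷ (U ++ reverse (h ∷ M) ++ G) ∷ʳ w
      ≡⟨ cong (v ∷_) (++-assoc U _ (w ∷ [])) ⟩
    v ∷ U ++ (reverse (h ∷ M) ++ G) ∷ʳ w
      ≡⟨ cong (λ X → v ∷ U ++ X) (++-assoc (reverse (h ∷ M)) G (w ∷ [])) ⟩
    v ∷ U ++ reverse (h ∷ M) ++ G ∷ʳ w ∎
    where open ≡-Reasoning

lemma2 : (n : ℕ) (π : List ℕ) → π ↭ applyUpTo suc n →
    (k : ℕ) → 1 ≤ k → k ≤ length (pins n π) →
    ((i j yi yj : ℕ) → 1 ≤ i → i ≤ k → k < j →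
      at (pins n π) i ≡ just yi → at (pins n π) j ≡ just yj → yi < yj) →
    (t y : ℕ) → t ≢ suc k → at (pins n π) t ≡ just y →
    length (filter (_<? y) (pins n π)) ≡ k →
    Σ ℕ (λ a → Σ ℕ (λ b →
      1 ≤ a × a ≤ b × b ≤ n ×
      ((x : ℕ) → (x ∈ pins n π) ⇔ (x ∈ pins n (revAt a b π))) ×
      at (pins n (revAt a b π)) (suc k) ≡ just y ×
      ((s : ℕ) → 1 ≤ s → s ≤ k → at (pins n (revAt a b π)) s ≡ at (pins n π) s) ×
      ((s : ℕ) → t < s → s ≤ length (pins n π) →
        at (pins n (revAt a b π)) s ≡ at (pins n π) s)))
lemma2 n π π↭ k 1≤k k≤ first-smallest t y _ at-t count =
  let a , b , 1≤a , a≤b , b≤|π| , ext-rev≡ = reverse-inside-ext π V M W xs≡ V≢[] M≢[] W≢[]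
  in a , b , 1≤a , a≤b , ≤-trans b≤|π| (≤-reflexive |π|≡n) ,
     subst (λ X → PinnacleMove k t y (pins n π) (pinsSeq X)) (sym ext-rev≡) move
  where
  open InnerReversal
    (inner-reversal (ext n π) k t y (ext-distinct π↭) (ext-ascending π↭) 1≤k k≤ first-smallest at-t count)
  |π|≡n = trans (↭-length π↭) (length-applyUpTo suc n)
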